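{- For every continuation $K$, all terms $M, M_1, M_2$ and every scalar $\alpha$: $\underline{K}[M_1+M_2]\to_a^{*}\underline{K}[M_1]+\underline{K}[M_2]$; $\underline{K}[\alpha.M]\to_a^{*}\alpha.\underline{K}[M]$; and $\underline{K}[0]\to_a^{*}0$.
   Context: Syntax. Fix a ring of scalars; $\alpha,\beta$ range over it. Terms: $M,N,L ::= V \mid MN \mid \alpha.M \mid M+N$; values $V,W ::= B \mid 0 \mid \alpha.V \mid V+W$; base values $B ::= x \mid \lambda x.M$. Terms are taken up to $\alpha$-conversion. Rewrite rules. $(A)$: $(M+N)L \to ML+NL$; $(\alpha.M)N \to \alpha.(MN)$; $(0)M \to 0$. $(L)$: $M+(N+L)\to(M+N)+L$; $(M+N)+L\to M+(N+L)$; $M+N\to N+M$; $\alpha.M+\beta.M\to(\alpha+\beta).M$; $\alpha.M+M\to(\alpha+1).M$; $M+M\to(1+1).M$; $\alpha.(\beta.M)\to(\alpha\beta).M$; $\alpha.(M+N)\to\alpha.M+\alpha.N$; $1.M\to M$; $0.M\to 0$; $\alpha.0\to 0$; $0+M\to M$. $(\xi)$: if $M\to M'$ then $MN\to M'N$, $M+N\to M'+N$, $N+M\to N+M'$, $\alpha.M\to\alpha.M'$. $\to_a$ is the relation generated by $A\cup L\cup\xi$ (context rules applying to $\to_a$ itself) and $\to_a^{*}$ is its reflexive-transitive closure. CPS grammar. Base computations $C ::= KB \mid BSK \mid TK$; computation combinations $D ::= C \mid 0 \mid \alpha.D \mid D_1+D_2$; base suspensions $S ::= x \mid \lambda k.C$;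 suspension combinations $T ::= S \mid 0 \mid \alpha.T \mid T_1+T_2$; continuations $K ::= k \mid \lambda b.bSK$; CPS-values $B ::= \lambda x.S$. Here $x$ ranges over ordinary variables, $k,b$ are reserved variables; $k$ occurs only as the continuation $k$ and as the binder in $\lambda k.C$; $b$ occurs only where displayed. Inverse translation: $\overline{KB}=\underline{K}[\phi(B)]$; $\overline{BSK}=\underline{K}[\phi(B)\sigma(S)]$; $\overline{TK}=\underline{K}[\sigma(T)]$; $\overline{0}=0$; $\overline{\alpha.D}=\alpha.\overline{D}$; $\overline{D_1+D_2}=\overline{D_1}+\overline{D_2}$; $\sigma(x)=x$; $\sigma(\lambda k.C)=\overline{C}$; $\sigma(0)=0$; $\sigma(\alpha.T)=\alpha.\sigma(T)$; $\sigma(T_1+T_2)=\sigma(T_1)+\sigma(T_2)$; $\phi(\lambda x.S)=\lambda x.\sigma(S)$; for a term $M$: $\underline{k}[M]=M$; $\underline{\lambda b.bSK}[M]=\underline{K}[M\,\sigma(S)]$. -}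

module Defs where

open import Level using (_⊔_)
open import Data.Nat using (ℕ)
open import Algebra.Bundles using (Ring)

-- Ordinary variables (names); k and b are reserved and handled structurally.
Var : Set
Var = ℕ

module Lang {c ℓ} (R : Ring c ℓ) where
  open Ring R using (_+_; _*_; 0#; 1#) renaming (Carrier to Scalar)

  data Term : Set c where
    var  : Var → Term
    lam  : Var → Term → Term
    app  : Term → Term → Term
    scal : Scalar → Term → Term
    plus : Term → Term → Term
    zero : Term

  data _⟶a_ : Term → Term → Set (c ⊔ ℓ) where
    A-plus  : ∀ M N L → app (plus M N) L ⟶a plus (app M L) (app N L)
    A-scal  : ∀ α M N → app (scal α M) N ⟶a scal α (app M N)
    A-zero  : ∀ M → app zero M ⟶a zero
    L-assocˡ : ∀ M N L → plus M (plus N L) ⟶a plus (plus M N) L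
    L-assocʳ : ∀ M N L → plus (plus M N) L ⟶a plus M (plus N L)
    L-comm   : ∀ M N → plus M N ⟶a plus N M
    L-fact   : ∀ α β M → plus (scal α M) (scal β M) ⟶a scal (α + β) M
    L-fact1  : ∀ α M → plus (scal α M) M ⟶a scal (α + 1#) M
    L-fact2  : ∀ M → plus M M ⟶a scal (1# + 1#) M
    L-scal   : ∀ α β M → scal α (scal β M) ⟶a scal (α * β) M
    L-dist   : ∀ α M N → scal α (plus M N) ⟶a plus (scal α M) (scal α N)
    L-one    : ∀ M → scal 1# M ⟶a M
    L-zeroS  : ∀ M → scal 0# M ⟶a zero
    L-zeroT  : ∀ α → scal α zero ⟶a zero
    L-unit   : ∀ M → plus zero M ⟶a M
    ξ-appˡ  : ∀ {M M′} N → M ⟶a M′ → app M N ⟶a app M′ N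
    ξ-plusˡ : ∀ {M M′} N → M ⟶a M′ → plus M N ⟶a plus M′ N
    ξ-plusʳ : ∀ {M M′} N → M ⟶a M′ → plus N M ⟶a plus N M′
    ξ-scal  : ∀ {M M′} α → M ⟶a M′ → scal α M ⟶a scal α M′

  data _⟶a*_ : Term → Term → Set (c ⊔ ℓ) where
    ε   : ∀ {M} → M ⟶a* M
    _◅_ : ∀ {M N L} → M ⟶a N → N ⟶a* L → M ⟶a* L

  infixr 5 _◅_

  mutual
    data Comp : Set c where
      KB  : Cont → CVal → Comp
      BSK : CVal → Susp → Cont → Comp
      TK  : SuspC → Cont → Comp

    -- base suspensions S ::= x | λk.C
    data Susp : Set c where
      svar : Var → Susp
      slam : Comp → Susp

    data SuspC : Set c where
      base  : Susp → SuspC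
      tzero : SuspC
      tscal : Scalar → SuspC → SuspC
      tplus : SuspC → SuspC → SuspC

    -- continuations K ::= k | λb.b S K
    data Cont : Set c where
      kvar : Cont
      klam : Susp → Cont → Cont

    data CVal : Set c where
      vlam : Var → Susp → CVal

  data CompC : Set c where
    cbase  : Comp → CompC
    czero  : CompC
    cscal  : Scalar → CompC → CompC
    cplus  : CompC → CompC → CompC

  mutual
    bar : Comp → Term
    bar (KB K B)    = fill K (φ B)
    bar (BSK B S K) = fill K (app (φ B) (σ S))
    bar (TK T K)    = fill K (σT T)

    σ : Susp → Term
    σ (svar x) = var x
    σ (slam C) = bar C

    σT : SuspC → Term
    σT (base S)    = σ S
    σT tzero       = zero
    σT (tscal α T) = scal α (σT T)
    σT (tplus T U) = plus (σT T) (σT U)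

    φ : CVal → Term
    φ (vlam x S) = lam x (σ S)

    fill : Cont → Term → Term
    fill kvar       M = M
    fill (klam S K) M = fill K (app M (σ S))

  barD : CompC → Term
  barD (cbase C)   = bar C
  barD czero       = zero
  barD (cscal α D) = scal α (barD D)
  barD (cplus D E) = plus (barD D) (barD E)

module Submission where

open import Defs
open import Algebra.Bundles using (Ring)
open import Data.Product using (_×_; _,_)

-- A continuation λb.bSK̲[M] is K̲[M σ(S)], so filling is a
-- sequence of applications M ↦ M σ(S) followed by the outer filling.
-- Each application is pushed inside a combination by exactly one
-- (A)-rule, and the outer filling preserves rewriting because every
-- hole position is the left argument of an application, which is a
-- (ξ)-context.

module Linearity {c ℓ} (R : Ring c ℓ) where
  open Lang R
  open Ring R using () renaming (Carrier to Scalar)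

  infixr 5 _◅◅_

  _◅◅_ : ∀ {M N L} → M ⟶a* N → N ⟶a* L → M ⟶a* L
  ε       ◅◅ q = q
  (s ◅ p) ◅◅ q = s ◅ (p ◅◅ q)

  -- A continuation context is a congruence for →a: the hole sits in
  -- the function position of nested applications (rule ξ-appˡ).
  fill-step : ∀ K {M N} → M ⟶a N → fill K M ⟶a* fill K N
  fill-step kvar       s = s ◅ ε
  fill-step (klam S K) s = fill-step K (ξ-appˡ (σ S) s)

  fill-plus : ∀ K M₁ M₂ → fill K (plus M₁ M₂) ⟶a* plus (fill K M₁) (fill K M₂)
  fill-plus kvar       M₁ M₂ = ε
  fill-plus (klam S K) M₁ M₂ =
    fill-step K (A-plus M₁ M₂ (σ S)) ◅◅ fill-plus K (app M₁ (σ S)) (app M₂ (σ S))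

  fill-scal : ∀ K (α : Scalar) M → fill K (scal α M) ⟶a* scal α (fill K M)
  fill-scal kvar       α M = ε
  fill-scal (klam S K) α M =
    fill-step K (A-scal α M (σ S)) ◅◅ fill-scal K α (app M (σ S))

  fill-zero : ∀ K → fill K zero ⟶a* zero
  fill-zero kvar       = ε
  fill-zero (klam S K) = fill-step K (A-zero (σ S)) ◅◅ fill-zero K

lemma4p12 : ∀ {c ℓ} (R : Ring c ℓ) → let open Lang R in
    (K : Cont) (M M₁ M₂ : Term) (α : Ring.Carrier R) →
    (fill K (plus M₁ M₂) ⟶a* plus (fill K M₁) (fill K M₂))
    × (fill K (scal α M) ⟶a* scal α (fill K M))
    × (fill K zero ⟶a* zero)
lemma4p12 R K M M₁ M₂ α = fill-plus K M₁ M₂ , fill-scal K α M , fill-zero K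
  where open Linearity R
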